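{- For all positive integers $n>m>r$, $$\rho(n)\ge\kappa(P_r,m)\,\rho(n-r).$$
   Context: Permutations of $[n]=\{1,\dots,n\}$ are written as sequences $(\pi(1),\dots,\pi(n))$. Two permutations $\pi,\sigma$ of $[n]$ are colliding if there is a position $i$ with $|\pi(i)-\sigma(i)|=1$. $\rho(n)$ is the maximum cardinality of a set of pairwise colliding permutations of $[n]$. For a simple graph $G$ with $V(G)\subseteq\mathbb{N}$, two permutations $\pi,\sigma$ of $[m]$ are $G$-different if $\{\pi(i),\sigma(i)\}\in E(G)$ for some $i$, and $\kappa(G,m)$ is the maximum number of pairwise $G$-different permutations of $[m]$. $P_r$ is the path with vertex set $[r]$ and edges $\{i,i+1\}$, $1\le i<r$. -}

module Defs where

open import Data.Nat using (ℕ; suc; _≤_; _<_; _∸_)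
open import Data.Fin using (Fin; toℕ)
open import Data.Fin.Permutation using (Permutation′; _⟨$⟩ʳ_)
open import Data.Product using (∃; _×_)
open import Data.Sum using (_⊎_)
open import Relation.Binary.PropositionalEquality using (_≡_; _≢_)
open import Relation.Nullary using (¬_)

-- A permutation of [n] = {1,…,n} is a bijection Fin n ↔ Fin n; positions i
-- are Fin n (position toℕ i + 1), and the value at position i is the
-- natural number  toℕ (π ⟨$⟩ʳ i) + 1  ∈ [n].
value : ∀ {n} → Permutation′ n → Fin n → ℕ
value π i = suc (toℕ (π ⟨$⟩ʳ i))

AbsDiffOne : ℕ → ℕ → Set
AbsDiffOne a b = (b ≡ suc a) ⊎ (a ≡ suc b)

Colliding : ∀ {n} → Permutation′ n → Permutation′ n → Set
Colliding {n} π σ = ∃ λ (i : Fin n) → AbsDiffOne (value π i) (value σ i)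

record SimpleGraph : Set₁ where
  field
    Adj   : ℕ → ℕ → Set
    sym   : ∀ {a b} → Adj a b → Adj b a
    irrefl : ∀ {a} → ¬ Adj a a

open SimpleGraph public

PathAdj : ℕ → ℕ → ℕ → Set
PathAdj r a b = (1 ≤ a × a ≤ r) × (1 ≤ b × b ≤ r) × AbsDiffOne a b

private
  absSym : ∀ {a b} → AbsDiffOne a b → AbsDiffOne b a
  absSym (Data.Sum.inj₁ e) = Data.Sum.inj₂ e
  absSym (Data.Sum.inj₂ e) = Data.Sum.inj₁ e

  n≢sn : ∀ {a} → ¬ (a ≡ suc a)
  n≢sn ()

  absIrr : ∀ {a} → ¬ AbsDiffOne a a
  absIrr (Data.Sum.inj₁ e) = n≢sn e
  absIrr (Data.Sum.inj₂ e) = n≢sn e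

P : ℕ → SimpleGraph
P r = record
  { Adj    = PathAdj r
  ; sym    = λ { (ha , hb , d) → hb , ha , absSym d }
  ; irrefl = λ { (_ , _ , d) → absIrr d }
  }
  where open Data.Product using (_,_)

GDifferent : SimpleGraph → ∀ {m} → Permutation′ m → Permutation′ m → Set
GDifferent G {m} π σ = ∃ λ (i : Fin m) → Adj G (value π i) (value σ i)

-- A set of k permutations of [n], given as an injective indexing Fin k → perms
-- (distinct members), that is pairwise related by R.
-- Distinctness of permutations is extensional (pointwise on positions).
PairwiseFamily : ∀ {n} → (Permutation′ n → Permutation′ n → Set) → ℕ → Set
PairwiseFamily {n} R k =
  ∃ λ (f : Fin k → Permutation′ n) →
    (∀ (a b : Fin k) → a ≢ b → ¬ (∀ (i : Fin n) → f a ⟨$⟩ʳ i ≡ f b ⟨$⟩ʳ i))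
    × (∀ (a b : Fin k) → a ≢ b → R (f a) (f b))

-- "ρ(n) ≥ k": some set of k pairwise colliding permutations of [n] exists.
CollidingFamily : ℕ → ℕ → Set
CollidingFamily n k = PairwiseFamily {n} Colliding k

-- "κ(G, m) ≥ k": some set of k pairwise G-different permutations of [m] exists.
GDifferentFamily : SimpleGraph → ℕ → ℕ → Set
GDifferentFamily G m k = PairwiseFamily {m} (GDifferent G) k

-- Let F be k pairwise P_r-different permutations of [m] and G be l pairwise
-- colliding permutations of [n − r].  For a ∈ F and b ∈ G put τ(a, b) = b̃ ∘ â,
-- where â acts as a on the first m positions and fixes the rest, and b̃ fixes
-- the values 1..r and acts as b, shifted by r, on the rest.  If a ≠ a', the
-- position where a and a' take adjacent values in [r] is untouched by b̃ and
-- b̃', so τ(a, b) and τ(a', b') collide there; if a = a' and b ≠ b', a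
-- collision of b and b' survives the shift by r and the common relabelling
-- of positions by â.
module Submission where

open import Defs hiding (sym)
open import Data.Nat using (ℕ; suc; _+_; _*_; _∸_; _<_; _≤_)
open import Data.Nat.Properties using (+-suc; 1+n≢n; m+[n∸m]≡n; <⇒≤; <-trans)
open import Data.Fin using (Fin; toℕ; _↑ˡ_; _↑ʳ_; remQuot; combine; _≟_)
open import Data.Fin.Properties
  using (+↔⊎; splitAt-↑ˡ; splitAt-↑ʳ; splitAt-<; splitAt⁻¹-↑ˡ; toℕ-↑ˡ; toℕ-↑ʳ; combine-remQuot)
open import Data.Fin.Permutation
  using (Permutation′; _⟨$⟩ʳ_; _⟨$⟩ˡ_; _∘ₚ_; _≈_; inverseʳ; id)
open import Data.Product using (_,_; uncurry)
open import Data.Sum using (inj₁; inj₂)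
open import Data.Sum.Function.Propositional using (_⊎-↔_)
open import Function using (_∘_)
open import Function.Properties.Inverse using (↔-trans; ↔-sym)
open import Relation.Binary.PropositionalEquality
  using (_≡_; _≢_; refl; sym; trans; cong; subst; subst₂)
open import Relation.Nullary using (¬_; yes; no)

AbsDiffOne-irrefl : ∀ {a} → ¬ AbsDiffOne a a
AbsDiffOne-irrefl (inj₁ a≡1+a) = 1+n≢n (sym a≡1+a)
AbsDiffOne-irrefl (inj₂ a≡1+a) = 1+n≢n (sym a≡1+a)

AbsDiffOne-+ˡ : ∀ r {a b} → AbsDiffOne a b → AbsDiffOne (r + a) (r + b)
AbsDiffOne-+ˡ r (inj₁ b≡1+a) = inj₁ (trans (cong (r +_) b≡1+a) (+-suc r _))
AbsDiffOne-+ˡ r (inj₂ a≡1+b) = inj₂ (trans (cong (r +_) a≡1+b) (+-suc r _))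

Colliding⇒≉ : ∀ {n} (π σ : Permutation′ n) → Colliding π σ → ¬ π ≈ σ
Colliding⇒≉ π σ (i , d) π≈σ =
  AbsDiffOne-irrefl (subst (AbsDiffOne _) (cong (suc ∘ toℕ) (sym (π≈σ i))) d)

Colliding-∘ₚ : ∀ {n} (ρ π σ : Permutation′ n) →
  Colliding π σ → Colliding (ρ ∘ₚ π) (ρ ∘ₚ σ)
Colliding-∘ₚ ρ π σ (i , d) =
  ρ ⟨$⟩ˡ i , subst₂ AbsDiffOne (sym (relabel π)) (sym (relabel σ)) d
  where
  relabel : ∀ π → value (ρ ∘ₚ π) (ρ ⟨$⟩ˡ i) ≡ value π i
  relabel π = cong (λ j → value π j) (inverseʳ ρ)

infixr 6 _⊕_

_⊕_ : ∀ {a b} → Permutation′ a → Permutation′ b → Permutation′ (a + b)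
π ⊕ σ = ↔-trans +↔⊎ (↔-trans (π ⊎-↔ σ) (↔-sym +↔⊎))

⊕-↑ˡ : ∀ {a b} (π : Permutation′ a) (σ : Permutation′ b) (i : Fin a) →
  (π ⊕ σ) ⟨$⟩ʳ (i ↑ˡ b) ≡ (π ⟨$⟩ʳ i) ↑ˡ b
⊕-↑ˡ {a} {b} π σ i rewrite splitAt-↑ˡ a i b = refl

⊕-↑ʳ : ∀ {a b} (π : Permutation′ a) (σ : Permutation′ b) (j : Fin b) →
  (π ⊕ σ) ⟨$⟩ʳ (a ↑ʳ j) ≡ a ↑ʳ (σ ⟨$⟩ʳ j)
⊕-↑ʳ {a} {b} π σ j rewrite splitAt-↑ʳ a b j = refl

id⊕-fixes-< : ∀ {r s} (σ : Permutation′ s) (y : Fin (r + s)) →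
  toℕ y < r → (id {r} ⊕ σ) ⟨$⟩ʳ y ≡ y
id⊕-fixes-< {r} σ y y<r rewrite splitAt-< r y y<r = splitAt⁻¹-↑ˡ (splitAt-< r y y<r)

value-id⊕-↑ʳ : ∀ {r s} (σ : Permutation′ s) (j : Fin s) →
  value (id {r} ⊕ σ) (r ↑ʳ j) ≡ r + value σ j
value-id⊕-↑ʳ {r} σ j =
  trans (cong suc (trans (cong toℕ (⊕-↑ʳ id σ j)) (toℕ-↑ʳ r (σ ⟨$⟩ʳ j)))) (sym (+-suc r _))

Colliding-id⊕ : ∀ {r s} (π σ : Permutation′ s) →
  Colliding π σ → Colliding (id {r} ⊕ π) (id ⊕ σ)
Colliding-id⊕ {r} π σ (j , d) =
  r ↑ʳ j , subst₂ AbsDiffOne (sym (value-id⊕-↑ʳ π j)) (sym (value-id⊕-↑ʳ σ j)) (AbsDiffOne-+ˡ r d)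

pad : ∀ {m t N} → m + t ≡ N → Permutation′ m → Permutation′ N
pad refl π = π ⊕ id

GDifferent-pad : ∀ G {m t N} (m+t≡N : m + t ≡ N) (π σ : Permutation′ m) →
  GDifferent G π σ → GDifferent G (pad m+t≡N π) (pad m+t≡N σ)
GDifferent-pad G {t = t} refl π σ (i , adj) =
  i ↑ˡ t , subst₂ (Adj G) (sym (value-pad π)) (sym (value-pad σ)) adj
  where
  value-pad : ∀ π → value (π ⊕ id {t}) (i ↑ˡ t) ≡ value π i
  value-pad π = cong suc (trans (cong toℕ (⊕-↑ˡ π id i)) (toℕ-↑ˡ (π ⟨$⟩ʳ i) t))

PathDifferent⇒Colliding-∘ₚ-id⊕ : ∀ {r s} (π π′ : Permutation′ (r + s)) (σ σ′ : Permutation′ s) →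
  GDifferent (P r) π π′ → Colliding (π ∘ₚ (id {r} ⊕ σ)) (π′ ∘ₚ (id ⊕ σ′))
PathDifferent⇒Colliding-∘ₚ-id⊕ {r} π π′ σ σ′ (i , (_ , πi≤r) , (_ , π′i≤r) , d) =
  i , subst₂ AbsDiffOne (sym (fixed π σ πi≤r)) (sym (fixed π′ σ′ π′i≤r)) d
  where
  fixed : ∀ π σ → toℕ (π ⟨$⟩ʳ i) < r → value (π ∘ₚ (id ⊕ σ)) i ≡ value π i
  fixed π σ πi<r = cong (suc ∘ toℕ) (id⊕-fixes-< σ (π ⟨$⟩ʳ i) πi<r)

remQuot-injective : ∀ {k} l {c c′ : Fin (k * l)} → remQuot {k} l c ≡ remQuot l c′ → c ≡ c′
remQuot-injective {k} l {c} {c′} eq =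
  trans (sym (combine-remQuot {k} l c)) (trans (cong (uncurry combine) eq) (combine-remQuot {k} l c′))

pairwise-grid : ∀ {n k l} {R : Permutation′ n → Permutation′ n → Set} →
  (∀ π σ → R π σ → ¬ π ≈ σ) →
  (τ : Fin k → Fin l → Permutation′ n) →
  (∀ {a a′} b b′ → a ≢ a′ → R (τ a b) (τ a′ b′)) →
  (∀ a {b b′} → b ≢ b′ → R (τ a b) (τ a b′)) →
  PairwiseFamily R (k * l)
pairwise-grid {k = k} {l} {R} R⇒≉ τ across-rows within-row =
  grid , (λ c c′ c≢c′ → R⇒≉ _ _ (related c c′ c≢c′)) , related
  where
  grid : Fin (k * l) → Permutation′ _
  grid c = uncurry τ (remQuot {k} l c)
  related-pairs : ∀ p p′ → p ≢ p′ → R (uncurry τ p) (uncurry τ p′)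
  related-pairs (a , b) (a′ , b′) p≢p′ with a ≟ a′
  ... | no a≢a′ = across-rows b b′ a≢a′
  ... | yes refl = within-row a (p≢p′ ∘ cong (a ,_))
  related : ∀ c c′ → c ≢ c′ → R (grid c) (grid c′)
  related c c′ c≢c′ = related-pairs _ _ (c≢c′ ∘ remQuot-injective l)

CollidingFamily-grid : ∀ {m t r s k l} → m + t ≡ r + s →
  GDifferentFamily (P r) m k → CollidingFamily s l → CollidingFamily (r + s) (k * l)
CollidingFamily-grid {r = r} {s} {k} {l} m+t≡r+s (F , _ , F-different) (G , _ , G-colliding) =
  pairwise-grid Colliding⇒≉ τ across-rows within-row
  where
  τ : Fin k → Fin l → Permutation′ (r + s)
  τ a b = pad m+t≡r+s (F a) ∘ₚ (id ⊕ G b)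
  across-rows : ∀ {a a′} b b′ → a ≢ a′ → Colliding (τ a b) (τ a′ b′)
  across-rows {a} {a′} b b′ a≢a′ =
    PathDifferent⇒Colliding-∘ₚ-id⊕ (pad m+t≡r+s (F a)) (pad m+t≡r+s (F a′)) (G b) (G b′)
      (GDifferent-pad (P r) m+t≡r+s (F a) (F a′) (F-different a a′ a≢a′))
  within-row : ∀ a {b b′} → b ≢ b′ → Colliding (τ a b) (τ a b′)
  within-row a {b} {b′} b≢b′ =
    Colliding-∘ₚ (pad m+t≡r+s (F a)) (id ⊕ G b) (id ⊕ G b′)
      (Colliding-id⊕ (G b) (G b′) (G-colliding b b′ b≢b′))

-- The hypotheses 0 < r and r < m serve only to give r ≤ n.
lemma3 : ∀ (n m r : ℕ) → 0 < r → r < m → m < n →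
    ∀ (k l : ℕ) → GDifferentFamily (P r) m k → CollidingFamily (n ∸ r) l →
    CollidingFamily n (k * l)
lemma3 n m r _ r<m m<n k l F G =
  subst (λ N → CollidingFamily N (k * l)) (m+[n∸m]≡n r≤n)
    (CollidingFamily-grid (trans (m+[n∸m]≡n m≤n) (sym (m+[n∸m]≡n r≤n))) F G)
  where
  m≤n : m ≤ n
  m≤n = <⇒≤ m<n
  r≤n : r ≤ n
  r≤n = <⇒≤ (<-trans r<m m<n)
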